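{- There exists a language $L$ (over a finite alphabet) such that $L\in\mathrm{DCFL}$, $L\notin\mathrm{REG}/n$, and $L$ is $\mathrm{REG}$-immune.
   Context: $\mathrm{REG}$ is the family of regular languages and $\mathrm{DCFL}$ the family of deterministic context-free languages (languages recognized by deterministic pushdown automata). For a family ${\cal C}$ of languages, ${\cal C}/n$ is the family of languages $L$ over an alphabet $\Sigma$ for which there exist an alphabet $\Gamma$, a function $h:\mathbb{N}\to\Gamma^*$ with $|h(n)|=n$ for all $n$, and a language $A\in{\cal C}$ over the alphabet $\Sigma\times\Gamma$ such that for every $x\in\Sigma^*$: $x\in L$ iff $\left[\begin{smallmatrix}x\\ h(|x|)\end{smallmatrix}\right]\in A$, where for $x=x_1\cdots x_n$, $y=y_1\cdots y_n$ the string $\left[\begin{smallmatrix}x\\ y\end{smallmatrix}\right]$ is the string $(x_1,y_1)(x_2,y_2)\cdots(x_n,y_n)$ over the product alphabet. A language $L$ is ${\cal C}$-immune if $L$ is infinite and no infinite subset of $L$ belongs to ${\cal C}$. -}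

module Defs where

open import Data.Nat using (ℕ)
open import Data.Fin using (Fin)
open import Data.Bool using (Bool; true)
open import Data.Maybe using (Maybe; just; nothing)
open import Data.List using (List; []; _∷_; _++_; length; zip; foldl)
open import Data.List.Membership.Propositional using (_∈_)
open import Data.Product using (Σ; _×_; _,_)
open import Relation.Nullary using (¬_)
open import Relation.Binary.PropositionalEquality using (_≡_; _≢_)
open import Relation.Binary.Construct.Closure.ReflexiveTransitive using (Star)
open import Function.Bundles using (_⇔_)

Language : Set → Set₁
Language A = List A → Set

_⊆L_ : {A : Set} → Language A → Language A → Set
L₁ ⊆L L₂ = ∀ x → L₁ x → L₂ x

Finite : {A : Set} → Language A → Set
Finite L = Σ (List _) λ xs → ∀ x → L x → x ∈ xs

Infinite : {A : Set} → Language A → Set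
Infinite L = ¬ Finite L

record DFA (A : Set) : Set where
  field
    nQ     : ℕ
    start  : Fin nQ
    δ      : Fin nQ → A → Fin nQ
    final  : Fin nQ → Bool

DFAAccepts : {A : Set} → DFA A → List A → Set
DFAAccepts D x = DFA.final D (foldl (DFA.δ D) (DFA.start D) x) ≡ true

REG : {A : Set} → Language A → Set
REG {A} L = Σ (DFA A) λ D → ∀ x → L x ⇔ DFAAccepts D x

record DPDA (A : Set) : Set where
  field
    nQ     : ℕ
    nZ     : ℕ
    start  : Fin nQ
    Z₀     : Fin nZ
    final  : Fin nQ → Bool
    -- δ q (just a) Z : move reading a;  δ q nothing Z : ε-move.
    -- The result (p , γ) replaces the top symbol Z by γ (head of γ = new top).
    δ      : Fin nQ → Maybe A → Fin nZ → Maybe (Fin nQ × List (Fin nZ))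
    det    : ∀ q a Z → δ q nothing Z ≢ nothing → δ q (just a) Z ≡ nothing

module _ {A : Set} (M : DPDA A) where
  open DPDA M

  Config : Set
  Config = Fin nQ × List A × List (Fin nZ)

  data Step : Config → Config → Set where
    read : ∀ {q p a w Z s γ} → δ q (just a) Z ≡ just (p , γ) →
           Step (q , a ∷ w , Z ∷ s) (p , w , γ ++ s)
    eps  : ∀ {q p w Z s γ} → δ q nothing Z ≡ just (p , γ) →
           Step (q , w , Z ∷ s) (p , w , γ ++ s)

  DPDAAccepts : List A → Set
  DPDAAccepts x = Σ (Fin nQ) λ q → Σ (List (Fin nZ)) λ s →
    Star Step (start , x , Z₀ ∷ []) (q , [] , s) × final q ≡ true

DCFL : {A : Set} → Language A → Set
DCFL {A} L = Σ (DPDA A) λ M → ∀ x → L x ⇔ DPDAAccepts M x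

REG/n : {A : Set} → Language A → Set₁
REG/n {A} L =
  Σ ℕ λ m → Σ (ℕ → List (Fin m)) λ h → (∀ n → length (h n) ≡ n) ×
  Σ (Language (A × Fin m)) λ B → REG B ×
    (∀ x → L x ⇔ B (zip x (h (length x))))

REG-Immune : {A : Set} → Language A → Set₁
REG-Immune {A} L = Infinite L ×
  ((R : Language A) → R ⊆L L → Infinite R → ¬ REG R)

-- The witness is the language of marked palindromes  w ♯ wᴿ  over {0, 1, ♯}, accepted by the
-- evident deterministic pushdown automaton.  Everything else rests on the fact that a word
-- u ♯ t without another mark is a marked palindrome only when t = uᴿ.  A finite automaton
-- reading the first half of a long marked palindrome repeats a state at two prefixes, so it
-- also accepts the word with the loop cut out, which has a shorter first half: no infinite
-- subset is regular.  With advice, the k + 1 words 0ⁱ1ᵏ⁻ⁱ read against the first k advice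
-- letters again collide in some state, so the automaton accepts a word u ♯ vᴿ with u ≠ v.
module Submission where

open import Defs
open import Data.Nat using (ℕ; zero; suc; _+_; _∸_; _≤_; _<_; s≤s)
open import Data.Nat.Properties
  using (≰⇒≥; ≮⇒≥; <⇒≱; <-irrefl; +-mono-<; +-monoˡ-<; m≤m+n; m+[n∸m]≡n;
         m≤n⇒m⊓n≡m; n<1+n; ≤-trans; ≤-reflexive; <⇒≤; module ≤-Reasoning)
open import Data.Fin using (Fin; zero; suc; toℕ; inject₁)
open import Data.Fin.Properties using (pigeonhole; toℕ≤pred[n]; inject₁-injective)
open import Data.Bool using (Bool; true; false)
open import Data.Maybe using (Maybe; just; nothing)
open import Data.List
  using (List; []; _∷_; _++_; _ʳ++_; length; map; foldl; take; drop; replicate; zip; reverse;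
         allFin; cartesianProductWith)
open import Data.List.Properties
  using (∷-injective; ++-assoc; foldl-++; take++drop≡id; length-++; length-map; length-take;
         length-drop; length-replicate; length-reverse; reverse-injective; map-injective;
         zipWith-zeroʳ)
open import Data.List.Extrema.Nat using (max; xs≤max)
open import Data.List.Membership.Propositional using (_∈_)
open import Data.List.Membership.Propositional.Properties
  using (∈-map⁺; ∈-allFin; ∈-cartesianProductWith⁺)
open import Data.List.Relation.Unary.All as All using (All; []; _∷_)
open import Data.List.Relation.Unary.All.Properties using (++⁺; take⁺; drop⁺; map⁺)
open import Data.List.Relation.Unary.Any using (here; there)
open import Data.Product using (Σ; ∃; ∃₂; _×_; _,_; proj₁; proj₂)
open import Data.Empty using (⊥; ⊥-elim)
open import Function using (_∘_)
open import Function.Bundles using (_⇔_; mk⇔; Equivalence)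
open import Relation.Nullary using (¬_)
open import Relation.Binary.PropositionalEquality
open import Relation.Binary.Construct.Closure.ReflexiveTransitive using (Star; ε; _◅_)

open Equivalence using (to; from)

module _ {A : Set} where

  ++-∷-cancel : ∀ {a : A} {x y t u} → All (_≢ a) x → All (_≢ a) y →
                x ++ a ∷ t ≡ y ++ a ∷ u → x ≡ y × t ≡ u
  ++-∷-cancel []          []          eq = refl , proj₂ (∷-injective eq)
  ++-∷-cancel []          (b≢a ∷ _)   eq = ⊥-elim (b≢a (sym (proj₁ (∷-injective eq))))
  ++-∷-cancel (b≢a ∷ _)   []          eq = ⊥-elim (b≢a (proj₁ (∷-injective eq)))
  ++-∷-cancel (_ ∷ x≢a)   (_ ∷ y≢a)   eq with ∷-injective eq
  ... | refl , eq′ with ++-∷-cancel x≢a y≢a eq′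
  ... | refl , t≡u = refl , t≡u

  zip-++ : ∀ {B : Set} (x y : List A) (bs : List B) →
           zip (x ++ y) bs ≡ zip x (take (length x) bs) ++ zip y (drop (length x) bs)
  zip-++ []      y bs       = refl
  zip-++ (a ∷ x) y []       = sym (zipWith-zeroʳ _,_ y)
  zip-++ (a ∷ x) y (b ∷ bs) = cong ((a , b) ∷_) (zip-++ x y bs)

  replicate-++-injectiveˡ : ∀ {a b : A} → a ≢ b → ∀ m n m′ n′ →
    replicate m a ++ replicate n b ≡ replicate m′ a ++ replicate n′ b → m ≡ m′
  replicate-++-injectiveˡ a≢b zero    n zero     n′ eq = refl
  replicate-++-injectiveˡ a≢b (suc m) n (suc m′) n′ eq =
    cong suc (replicate-++-injectiveˡ a≢b m n m′ n′ (proj₂ (∷-injective eq)))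
  replicate-++-injectiveˡ a≢b zero (suc n) (suc m′) n′ eq =
    ⊥-elim (a≢b (sym (proj₁ (∷-injective eq))))
  replicate-++-injectiveˡ a≢b (suc m) n zero (suc n′) eq =
    ⊥-elim (a≢b (proj₁ (∷-injective eq)))
  replicate-++-injectiveˡ a≢b zero zero (suc m′) n′ ()
  replicate-++-injectiveˡ a≢b (suc m) n zero zero ()

  unbounded⇒infinite : {L : Language A} → (∀ n → ∃ λ x → L x × n ≤ length x) → Infinite L
  unbounded⇒infinite unbounded (xs , covered) with unbounded (suc (max 0 (map length xs)))
  ... | x , Lx , long =
    <⇒≱ long (All.lookup (xs≤max 0 (map length xs)) (∈-map⁺ length (covered x Lx)))

wordsUpTo : ∀ {k} → ℕ → List (List (Fin k))
wordsUpTo zero    = [] ∷ []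
wordsUpTo (suc n) = [] ∷ cartesianProductWith _∷_ (allFin _) (wordsUpTo n)

∈-wordsUpTo : ∀ {k n} (x : List (Fin k)) → length x ≤ n → x ∈ wordsUpTo n
∈-wordsUpTo {n = zero}  []      _             = here refl
∈-wordsUpTo {n = suc n} []      _             = here refl
∈-wordsUpTo {n = suc n} (a ∷ x) (s≤s |x|≤n) =
  there (∈-cartesianProductWith⁺ _∷_ (∈-allFin a) (∈-wordsUpTo x |x|≤n))

infinite⇒unbounded : ∀ {k} {L : Language (Fin k)} → Infinite L →
                     ∀ n → ¬ ¬ (∃ λ x → L x × n ≤ length x)
infinite⇒unbounded infinite n noLong =
  infinite (wordsUpTo n , λ x Lx → ∈-wordsUpTo x (≰⇒≥ (λ n≤|x| → noLong (x , Lx , n≤|x|))))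

module _ {A : Set} (D : DFA A) where
  open DFA D

  state : List A → Fin nQ
  state = foldl δ start

  Indistinguishable : List A → List A → Set
  Indistinguishable x y = ∀ v → DFAAccepts D (x ++ v) ⇔ DFAAccepts D (y ++ v)

  state≡⇒indistinguishable : ∀ {x y} → state x ≡ state y → Indistinguishable x y
  state≡⇒indistinguishable {x} {y} eq v = mk⇔ (trans (cong final (sym same-end)))
                                              (trans (cong final same-end))
    where
    open ≡-Reasoning
    same-end : state (x ++ v) ≡ state (y ++ v)
    same-end = begin
      state (x ++ v)       ≡⟨ foldl-++ δ start x v ⟩
      foldl δ (state x) v  ≡⟨ cong (λ q → foldl δ q v) eq ⟩
      foldl δ (state y) v  ≡⟨ foldl-++ δ start y v ⟨
      state (y ++ v)       ∎

  pigeonhole-indistinguishable : (f : Fin (suc nQ) → List A) →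
    ∃₂ λ i j → toℕ i < toℕ j × Indistinguishable (f i) (f j)
  pigeonhole-indistinguishable f with pigeonhole (n<1+n nQ) (state ∘ f)
  ... | i , j , i<j , eq = i , j , i<j , state≡⇒indistinguishable {f i} {f j} eq

  pump-down : ∀ u t → nQ ≤ length u → DFAAccepts D (u ++ t) →
              ∃₂ λ i j → i < j × j ≤ length u × DFAAccepts D (take i u ++ drop j u ++ t)
  pump-down u t nQ≤|u| accepted with pigeonhole-indistinguishable (λ i → take (toℕ i) u)
  ... | i , j , i<j , indist =
    toℕ i , toℕ j , i<j , ≤-trans (toℕ≤pred[n] j) nQ≤|u| ,
    from (indist (drop (toℕ j) u ++ t)) (subst (DFAAccepts D) (sym split) accepted)
    where
    split : take (toℕ j) u ++ drop (toℕ j) u ++ t ≡ u ++ t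
    split = trans (sym (++-assoc (take (toℕ j) u) _ t)) (cong (_++ t) (take++drop≡id (toℕ j) u))

Letter : Set
Letter = Fin 3

Bit : Set
Bit = Fin 2

bit : Bit → Letter
bit = inject₁

pattern mark = suc (suc zero)

bit≢mark : ∀ b → bit b ≢ mark
bit≢mark zero       ()
bit≢mark (suc zero) ()

NoMark : List Letter → Set
NoMark = All (_≢ mark)

noMark-bits : ∀ w → NoMark (map bit w)
noMark-bits w = map⁺ (All.tabulate λ {b} _ → bit≢mark b)

glue : List Bit → List Bit → List Letter
glue v w = map bit v ++ mark ∷ reverse (map bit w)

mirror : List Bit → List Letter
mirror w = glue w w

Mirror : Language Letter
Mirror x = ∃ λ w → x ≡ mirror w

length-glue : ∀ v w → length (glue v w) ≡ length v + suc (length w)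
length-glue v w = begin
  length (glue v w)                                     ≡⟨ length-++ (map bit v) ⟩
  length (map bit v) + suc (length (reverse (map bit w))) ≡⟨ cong₂ (λ m n → m + suc n)
                                                              (length-map bit v)
                                                              (trans (length-reverse (map bit w))
                                                                     (length-map bit w)) ⟩
  length v + suc (length w)                             ∎
  where open ≡-Reasoning

Mirror-tail : ∀ {x t} → NoMark x → Mirror (x ++ mark ∷ t) → t ≡ reverse x
Mirror-tail x≢♯ (w , eq) with ++-∷-cancel x≢♯ (noMark-bits w) eq
... | refl , t≡ = t≡

Mirror-glue⇒≡ : ∀ {v w} → Mirror (glue v w) → v ≡ w
Mirror-glue⇒≡ {v} {w} m =
  sym (map-injective inject₁-injective (reverse-injective (Mirror-tail (noMark-bits v) m)))

Mirror-cut : ∀ u {i j} → NoMark u → i < j → j ≤ length u →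
             ¬ Mirror (take i u ++ drop j u ++ mark ∷ reverse u)
Mirror-cut u {i} {j} u≢♯ i<j j≤|u| m = <-irrefl (sym same-length) shorter
  where
  u′ = take i u ++ drop j u
  tail≡ : reverse u ≡ reverse u′
  tail≡ = Mirror-tail (++⁺ (take⁺ i u≢♯) (drop⁺ j u≢♯))
                      (subst Mirror (sym (++-assoc (take i u) (drop j u) _)) m)
  same-length : length u ≡ length u′
  same-length = trans (sym (length-reverse u)) (trans (cong length tail≡) (length-reverse u′))
  shorter : length u′ < length u
  shorter = begin-strict
    length u′                   ≡⟨ length-++ (take i u) ⟩
    length (take i u) + length (drop j u)
                                ≡⟨ cong₂ _+_ (trans (length-take i u)
                                               (m≤n⇒m⊓n≡m (≤-trans (<⇒≤ i<j) j≤|u|)))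
                                             (length-drop j u) ⟩
    i + (length u ∸ j)          <⟨ +-monoˡ-< (length u ∸ j) i<j ⟩
    j + (length u ∸ j)          ≡⟨ m+[n∸m]≡n j≤|u| ⟩
    length u                    ∎
    where open ≤-Reasoning

-- The first bit is pushed as a bottom symbol, so that popping it can be recognised without
-- an ε-move; the machine therefore has no ε-moves at all.
Q : Set
Q = Fin 4

pattern initial = zero
pattern push    = suc zero
pattern pop     = suc (suc zero)
pattern accept  = suc (suc (suc zero))

Γ : Set
Γ = Fin 5

pattern Z₀      = zero
pattern pushed₀ = suc zero
pattern pushed₁ = suc (suc zero)
pattern bottom₀ = suc (suc (suc zero))
pattern bottom₁ = suc (suc (suc (suc zero)))

pushed : Bit → Γ
pushed zero       = pushed₀
pushed (suc zero) = pushed₁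

bottom : Bit → Γ
bottom zero       = bottom₀
bottom (suc zero) = bottom₁

transition : Q → Maybe Letter → Γ → Maybe (Q × List Γ)
transition _       nothing           _       = nothing
transition initial (just mark)       Z₀      = just (accept , [])
transition initial (just zero)       Z₀      = just (push , bottom₀ ∷ [])
transition initial (just (suc zero)) Z₀      = just (push , bottom₁ ∷ [])
transition push    (just mark)       Z       = just (pop , Z ∷ [])
transition push    (just zero)       Z       = just (push , pushed₀ ∷ Z ∷ [])
transition push    (just (suc zero)) Z       = just (push , pushed₁ ∷ Z ∷ [])
transition pop     (just zero)       pushed₀ = just (pop , [])
transition pop     (just (suc zero)) pushed₁ = just (pop , [])
transition pop     (just zero)       bottom₀ = just (accept , [])
transition pop     (just (suc zero)) bottom₁ = just (accept , [])
transition _       _                 _       = nothing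

isAccept : Q → Bool
isAccept accept = true
isAccept _      = false

mirrorDPDA : DPDA Letter
mirrorDPDA = record
  { nQ = 4 ; nZ = 5 ; start = initial ; Z₀ = Z₀ ; final = isAccept ; δ = transition
  ; det = λ _ _ _ ε-move → ⊥-elim (ε-move refl) }

run : Q → List Letter → List Γ → Maybe (Q × List Γ)
run q []      s       = just (q , s)
run q (a ∷ x) []      = nothing
run q (a ∷ x) (Z ∷ s) with transition q (just a) Z
... | nothing      = nothing
... | just (p , γ) = run p x (γ ++ s)

Step*⇒run : ∀ {q x s q′ s′} → Star (Step mirrorDPDA) (q , x , s) (q′ , [] , s′) →
            run q x s ≡ just (q′ , s′)
Step*⇒run ε                         = refl
Step*⇒run (read δ≡ ◅ steps) rewrite δ≡ = Step*⇒run steps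
Step*⇒run (eps () ◅ _)

run⇒Step* : ∀ q x s {q′ s′} → run q x s ≡ just (q′ , s′) →
            Star (Step mirrorDPDA) (q , x , s) (q′ , [] , s′)
run⇒Step* q []      s       refl = ε
run⇒Step* q (a ∷ x) (Z ∷ s) ran with transition q (just a) Z in δ≡
... | just (p , γ) = read δ≡ ◅ run⇒Step* p x (γ ++ s) ran

AcceptsFrom : Q → List Γ → List Letter → Set
AcceptsFrom q s y = ∃₂ λ q′ s′ → run q y s ≡ just (q′ , s′) × isAccept q′ ≡ true

DPDAAccepts⇔AcceptsFrom : ∀ x → DPDAAccepts mirrorDPDA x ⇔ AcceptsFrom initial (Z₀ ∷ []) x
DPDAAccepts⇔AcceptsFrom x = mk⇔
  (λ (q , s , steps , final) → q , s , Step*⇒run steps , final)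
  (λ (q , s , ran , final) → q , s , run⇒Step* initial x (Z₀ ∷ []) ran , final)

push-then-pop : ∀ v Z s y →
                run push (map bit v ++ mark ∷ (map bit v ʳ++ y)) (Z ∷ s) ≡ run pop y (Z ∷ s)
push-then-pop []             Z s y = refl
push-then-pop (zero ∷ v)     Z s y = push-then-pop v pushed₀ (Z ∷ s) (zero ∷ y)
push-then-pop (suc zero ∷ v) Z s y = push-then-pop v pushed₁ (Z ∷ s) (suc zero ∷ y)

mirror-accepted : ∀ w → AcceptsFrom initial (Z₀ ∷ []) (mirror w)
mirror-accepted []             = accept , [] , refl , refl
mirror-accepted (zero ∷ v)     = accept , [] , push-then-pop v bottom₀ [] (zero ∷ []) , refl
mirror-accepted (suc zero ∷ v) = accept , [] , push-then-pop v bottom₁ [] (suc zero ∷ []) , refl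

AcceptsOnly : Q → List Γ → List Letter → Set
AcceptsOnly q s y₀ = ∀ y → AcceptsFrom q s y → y ≡ y₀

accept-only-[] : AcceptsOnly accept [] []
accept-only-[] []      _                = refl
accept-only-[] (_ ∷ _) (_ , _ , () , _)

pop-bottom : ∀ b → AcceptsOnly pop (bottom b ∷ []) (bit b ∷ [])
pop-bottom _          []                 (_ , _ , refl , ())
pop-bottom zero       (zero ∷ y)         acc = cong (zero ∷_) (accept-only-[] y acc)
pop-bottom (suc zero) (suc zero ∷ y)     acc = cong (suc zero ∷_) (accept-only-[] y acc)
pop-bottom zero       (suc zero ∷ _)     (_ , _ , () , _)
pop-bottom zero       (mark ∷ _)         (_ , _ , () , _)
pop-bottom (suc zero) (zero ∷ _)         (_ , _ , () , _)
pop-bottom (suc zero) (mark ∷ _)         (_ , _ , () , _)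

pop-pushed : ∀ b {s y₀} → AcceptsOnly pop s y₀ → AcceptsOnly pop (pushed b ∷ s) (bit b ∷ y₀)
pop-pushed _          only []             (_ , _ , refl , ())
pop-pushed zero       only (zero ∷ y)     acc = cong (zero ∷_) (only y acc)
pop-pushed (suc zero) only (suc zero ∷ y) acc = cong (suc zero ∷_) (only y acc)
pop-pushed zero       only (suc zero ∷ _) (_ , _ , () , _)
pop-pushed zero       only (mark ∷ _)     (_ , _ , () , _)
pop-pushed (suc zero) only (zero ∷ _)     (_ , _ , () , _)
pop-pushed (suc zero) only (mark ∷ _)     (_ , _ , () , _)

push-accepts : ∀ y Z s y₀ → AcceptsOnly pop (Z ∷ s) y₀ → AcceptsFrom push (Z ∷ s) y →
               ∃ λ v → y ≡ map bit v ++ mark ∷ (map bit v ʳ++ y₀)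
push-accepts []             Z s y₀ only (_ , _ , refl , ())
push-accepts (mark ∷ y)     Z s y₀ only acc = [] , cong (mark ∷_) (only y acc)
push-accepts (zero ∷ y)     Z s y₀ only acc
  with v , refl ← push-accepts y pushed₀ (Z ∷ s) (zero ∷ y₀) (pop-pushed zero only) acc
  = zero ∷ v , refl
push-accepts (suc zero ∷ y) Z s y₀ only acc
  with v , refl ← push-accepts y pushed₁ (Z ∷ s) (suc zero ∷ y₀) (pop-pushed (suc zero) only) acc
  = suc zero ∷ v , refl

accepted⇒Mirror : ∀ x → AcceptsFrom initial (Z₀ ∷ []) x → Mirror x
accepted⇒Mirror []             (_ , _ , refl , ())
accepted⇒Mirror (mark ∷ [])    _                  = [] , refl
accepted⇒Mirror (mark ∷ _ ∷ _) (_ , _ , () , _)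
accepted⇒Mirror (zero ∷ y)     acc
  with v , refl ← push-accepts y bottom₀ [] (zero ∷ []) (pop-bottom zero) acc
  = zero ∷ v , refl
accepted⇒Mirror (suc zero ∷ y) acc
  with v , refl ← push-accepts y bottom₁ [] (suc zero ∷ []) (pop-bottom (suc zero)) acc
  = suc zero ∷ v , refl

Mirror-DCFL : DCFL Mirror
Mirror-DCFL = mirrorDPDA , λ x → mk⇔
  (λ { (w , refl) → from (DPDAAccepts⇔AcceptsFrom x) (mirror-accepted w) })
  (accepted⇒Mirror x ∘ to (DPDAAccepts⇔AcceptsFrom x))

Mirror-infinite : Infinite Mirror
Mirror-infinite = unbounded⇒infinite long-mirror
  where
  long-mirror : ∀ n → ∃ λ x → Mirror x × n ≤ length x
  long-mirror n = mirror zeros , (zeros , refl) ,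
    ≤-trans (m≤m+n n (suc n))
            (≤-reflexive (sym (trans (length-glue zeros zeros)
                                     (cong (λ m → m + suc m) (length-replicate n)))))
    where zeros = replicate n zero

no-infinite-regular-subset : (R : Language Letter) → R ⊆L Mirror → Infinite R → ¬ REG R
no-infinite-regular-subset R R⊆Mirror infinite (D , R⇔D) =
  infinite⇒unbounded infinite (k + suc k) λ (z , Rz , long) → cut (R⊆Mirror z Rz) Rz long
  where
  k = DFA.nQ D
  first-half-long : ∀ w → k + suc k ≤ length (mirror w) → k ≤ length (map bit w)
  first-half-long w long = subst (k ≤_) (sym (length-map bit w)) (≮⇒≥ λ |w|<k →
    <⇒≱ (+-mono-< |w|<k (s≤s |w|<k)) (subst (k + suc k ≤_) (length-glue w w) long))
  cut : ∀ {z} → Mirror z → R z → k + suc k ≤ length z → ⊥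
  cut (w , refl) Rz long with pump-down D (map bit w) _ (first-half-long w long) (to (R⇔D _) Rz)
  ... | i , j , i<j , j≤|u| , accepted =
    Mirror-cut (map bit w) (noMark-bits w) i<j j≤|u| (R⊆Mirror _ (from (R⇔D _) accepted))

module _ {m} (D : DFA (Letter × Fin m)) (advice : List (Fin m)) where
  private
    k : ℕ
    k = DFA.nQ D

    W : Fin (suc k) → List Bit
    W i = replicate (toℕ i) zero ++ replicate (k ∸ toℕ i) (suc zero)

    length-W : ∀ i → length (W i) ≡ k
    length-W i = begin
      length (W i)                   ≡⟨ length-++ (replicate (toℕ i) zero) ⟩
      length (replicate (toℕ i) zero) + length (replicate (k ∸ toℕ i) (suc zero))
                                     ≡⟨ cong₂ _+_ (length-replicate (toℕ i))
                                                  (length-replicate (k ∸ toℕ i)) ⟩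
      toℕ i + (k ∸ toℕ i)            ≡⟨ m+[n∸m]≡n (toℕ≤pred[n] i) ⟩
      k                              ∎
      where open ≡-Reasoning

    zip-glue : ∀ v w → length v ≡ k → zip (glue v w) advice ≡
               zip (map bit v) (take k advice) ++ zip (mark ∷ reverse (map bit w)) (drop k advice)
    zip-glue v w |v|≡k = trans (zip-++ (map bit v) _ advice)
      (cong (λ n → zip (map bit v) (take n advice) ++
                   zip (mark ∷ reverse (map bit w)) (drop n advice))
            (trans (length-map bit v) |v|≡k))

  accepts-mismatched-glue : (∀ w → length w ≡ k → DFAAccepts D (zip (mirror w) advice)) →
    ∃₂ λ v w → v ≢ w × length v ≡ k × length w ≡ k × DFAAccepts D (zip (glue v w) advice)
  accepts-mismatched-glue accepts-mirror
    with pigeonhole-indistinguishable D (λ i → zip (map bit (W i)) (take k advice))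
  ... | i , j , i<j , indist = W j , W i , W-distinct , length-W j , length-W i , accepted
    where
    W-distinct : W j ≢ W i
    W-distinct eq = <-irrefl (sym (replicate-++-injectiveˡ (λ ()) (toℕ j) _ (toℕ i) _ eq)) i<j
    accepted : DFAAccepts D (zip (glue (W j) (W i)) advice)
    accepted = subst (DFAAccepts D) (sym (zip-glue (W j) (W i) (length-W j)))
      (to (indist (zip (mark ∷ reverse (map bit (W i))) (drop k advice)))
          (subst (DFAAccepts D) (zip-glue (W i) (W i) (length-W i))
                 (accepts-mirror (W i) (length-W i))))

Mirror∉REG/n : ¬ REG/n Mirror
Mirror∉REG/n (m , h , _ , B , (D , B⇔D) , Mirror⇔B) =
  let v , w , v≢w , |v|≡k , |w|≡k , accepted = accepts-mismatched-glue D (h n) accepts-mirror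
  in v≢w (Mirror-glue⇒≡ (from (Mirror⇔B _) (from (B⇔D _)
       (subst (AcceptsWithAdvice (glue v w)) (sym (length-glue-k v w |v|≡k |w|≡k)) accepted))))
  where
  k = DFA.nQ D
  n = k + suc k
  AcceptsWithAdvice : List Letter → ℕ → Set
  AcceptsWithAdvice x l = DFAAccepts D (zip x (h l))
  length-glue-k : ∀ v w → length v ≡ k → length w ≡ k → length (glue v w) ≡ n
  length-glue-k v w |v|≡k |w|≡k = trans (length-glue v w) (cong₂ (λ a b → a + suc b) |v|≡k |w|≡k)
  accepts-mirror : ∀ w → length w ≡ k → AcceptsWithAdvice (mirror w) n
  accepts-mirror w |w|≡k = subst (AcceptsWithAdvice (mirror w)) (length-glue-k w w |w|≡k |w|≡k)
                                 (to (B⇔D _) (to (Mirror⇔B _) (w , refl)))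

Mirror-REG-immune : REG-Immune Mirror
Mirror-REG-immune = Mirror-infinite , no-infinite-regular-subset

proposition3p1 : Σ ℕ λ k → Σ (Language (Fin k)) λ L →
    DCFL L × ¬ REG/n L × REG-Immune L
proposition3p1 = 3 , Mirror , Mirror-DCFL , Mirror∉REG/n , Mirror-REG-immune
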